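{- Let $q$ be a prime power, $n\geq 1$, and let $\Psi\in\mathrm{PGL}_{n+1}(\mathbb{F}_q)$ act transitively on $\mathbb{P}^n(\mathbb{F}_q)$. Then the absolute fractional jump index of $\Psi$ satisfies $\mathfrak{J}_\Psi=n+1$.
   Context: Fix projective coordinates $X_0,\dots,X_n$ on $\mathbb{P}^n=\mathbb{P}^n(\mathbb{F}_q)$ and let $U=\{[X_0:\dots:X_n]: X_n\neq 0\}$ (the affine chart, identified with $\mathbb{F}_q^n$). For $P\in U$, the fractional jump index of $\Psi$ at $P$ is $\mathfrak{J}_{P,\Psi}=\min\{k\geq 1: \Psi^k(P)\in U\}$, and the absolute fractional jump index is $\mathfrak{J}_\Psi=\max\{\mathfrak{J}_{P,\Psi}: P\in U\}$. $\Psi$ is transitive if it has a single orbit on $\mathbb{P}^n(\mathbb{F}_q)$. -}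

module Defs where

open import Level using (Level; _⊔_)
open import Data.Nat as ℕ using (ℕ; zero; suc; _≤_; _<_; _^_)
open import Data.Nat.Primality using (Prime)
open import Data.Fin using (Fin; zero; suc; fromℕ; _≟_)
open import Relation.Nullary using (yes; no)
open import Data.Product using (Σ; ∃; _×_; _,_)
open import Relation.Nullary using (¬_)
open import Relation.Binary.PropositionalEquality as ≡ using (_≡_)
open import Algebra.Bundles using (CommutativeRing)
open import Function.Bundles using (Inverse)

IsPrimePower : ℕ → Set
IsPrimePower q = Σ ℕ λ p → Σ ℕ λ k → Prime p × q ≡ p ^ ℕ.suc k

record Field (c ℓ : Level) : Set (Level.suc (c ⊔ ℓ)) where
  field
    commutativeRing : CommutativeRing c ℓ
  open CommutativeRing commutativeRing public
  field
    0≉1 : ¬ (0# ≈ 1#)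
    inverse : ∀ x → ¬ (x ≈ 0#) → Σ Carrier λ y → x * y ≈ 1#

HasCardinality : ∀ {c ℓ} → Field c ℓ → ℕ → Set (c ⊔ ℓ)
HasCardinality F q = Inverse (Field.setoid F) (≡.setoid (Fin q))

module LinearAlgebra {c ℓ} (F : Field c ℓ) where
  open Field F hiding (zero)

  Σ[_] : ∀ {m} → (Fin m → Carrier) → Carrier
  Σ[_] {zero} f = 0#
  Σ[_] {suc m} f = f zero + Σ[_] (λ i → f (suc i))

  Vector : ℕ → Set c
  Vector m = Fin m → Carrier

  Matrix : ℕ → Set c
  Matrix m = Fin m → Fin m → Carrier

  identity : ∀ {m} → Matrix m
  identity i j with i ≟ j
  ... | yes _ = 1#
  ... | no _ = 0#

  _⊗_ : ∀ {m} → Matrix m → Matrix m → Matrix m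
  (A ⊗ B) i j = Σ[ (λ k → A i k * B k j) ]

  _·_ : ∀ {m} → Matrix m → Vector m → Vector m
  (A · v) i = Σ[ (λ j → A i j * v j) ]

  _≈M_ : ∀ {m} → Matrix m → Matrix m → Set ℓ
  A ≈M B = ∀ i j → A i j ≈ B i j

  Invertible : ∀ {m} → Matrix m → Set (c ⊔ ℓ)
  Invertible {m} A = Σ (Matrix m) λ B → (A ⊗ B) ≈M identity × (B ⊗ A) ≈M identity

  iterate : ∀ {m} → Matrix m → ℕ → Vector m → Vector m
  iterate A zero v = v
  iterate A (suc k) v = A · iterate A k v

  -- a vector representing a point of projective space
  NonZeroVec : ∀ {m} → Vector m → Set ℓ
  NonZeroVec v = ∃ λ i → ¬ (v i ≈ 0#)

  _∼_ : ∀ {m} → Vector m → Vector m → Set (c ⊔ ℓ)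
  v ∼ w = Σ Carrier λ λ' → ¬ (λ' ≈ 0#) × (∀ i → v i ≈ λ' * w i)

  -- projective space P^n with coordinates X_0 .. X_n  (vectors of length n+1)
  -- U = { X_n ≠ 0 }
  InU : ∀ {n} → Vector (suc n) → Set ℓ
  InU {n} v = ¬ (v (fromℕ n) ≈ 0#)

  Transitive : ∀ {n} → Matrix (suc n) → Set (c ⊔ ℓ)
  Transitive A = ∀ v w → NonZeroVec v → NonZeroVec w → ∃ λ k → iterate A k v ∼ w

  IsJumpIndexAt : ∀ {n} → Matrix (suc n) → Vector (suc n) → ℕ → Set ℓ
  IsJumpIndexAt A v k =
    1 ≤ k × InU (iterate A k v) × (∀ j → 1 ≤ j → j < k → ¬ InU (iterate A j v))

  IsAbsoluteJumpIndex : ∀ {n} → Matrix (suc n) → ℕ → Set (c ⊔ ℓ)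
  IsAbsoluteJumpIndex A J =
    (∀ v → InU v → ∃ λ k → IsJumpIndexAt A v k × k ≤ J)
    × (∃ λ v → InU v × IsJumpIndexAt A v J)

{-# OPTIONS --safe #-}
-- Let s(k) be the X_n-coordinate of Ψᵏ(v), so that the jump index at [v] ∈ U is the least
-- k ≥ 1 with s(k) ≠ 0.  The n + 2 vectors v, Av, …, Aⁿ⁺¹v of 𝔽_q^{n+1} are linearly dependent
-- (pigeonhole on 𝔽_q^{n+2} → 𝔽_q^{n+1}), so s satisfies a linear recurrence of order at
-- most n + 1; hence n + 1 consecutive zeros of s force s ≡ 0.  Transitivity forbids s(k) = 0
-- for all k ≥ 1, which gives 𝔍_Ψ ≤ n + 1.  For the reverse bound, pigeonhole on
-- 𝔽_q^{n+1} → 𝔽_q^n gives v ≠ 0 with s(1) = … = s(n) = 0; then s(0) ≠ 0 (else s ≡ 0), so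
-- [v] ∈ U and its jump index is exactly n + 1.
module Submission where

open import Defs
open import Level using (_⊔_)
open import Data.Nat using (ℕ; suc; _≤_)
open import Data.Nat as ℕ using (zero; z≤n; s≤s; _<_; _∸_; _^_)
open import Data.Nat.Properties
  using (<-cmp; _<?_; ≮⇒≥; m∸n+n≡m; +-monoʳ-<; ^-monoʳ-<; n<1+n; <-≤-trans; m<1+n⇒m<n∨m≡n)
open import Data.Nat.Induction using (<-rec)
open import Data.Fin as Fin using (Fin; zero; suc; toℕ; fromℕ; fromℕ<; inject; funToFin; finToFun)
open import Data.Fin.Properties
  using (toℕ<n; toℕ-injective; toℕ-fromℕ<; toℕ-inject; any?; ¬∀⟶∃¬; ¬∀⟶∃¬-smallest; pigeonhole;
         funToFin-finToFin; finToFun-funToFin)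
import Data.Fin.Properties as Fin
open import Data.Product using (∃; _×_; _,_)
open import Data.Sum using (inj₁; inj₂)
open import Data.Empty using (⊥-elim)
open import Function using (_∘_)
open import Function.Bundles using (Inverse)
open import Relation.Nullary using (¬_; yes; no)
open import Relation.Nullary.Decidable using (¬?; decidable-stable)
open import Relation.Binary using (Decidable; tri<; tri≈; tri>)
open import Relation.Binary.PropositionalEquality as ≡ using (_≡_; _≢_)

module FieldFacts {c ℓ} (F : Field c ℓ) where
  open Field F hiding (zero)
  open LinearAlgebra F
  open import Relation.Binary.Reasoning.Setoid setoid
  open import Algebra.Properties.Ring ring using (x[y-z]≈xy-xz; [y-z]x≈yx-zx)
  open import Algebra.Properties.Group +-group using (ε⁻¹≈ε)
  open import Algebra.Properties.AbelianGroup +-abelianGroup using (⁻¹-∙-comm)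
  open import Algebra.Properties.CommutativeSemigroup +-commutativeSemigroup using (interchange)
  open import Algebra.Properties.CommutativeSemigroup *-commutativeSemigroup
    using (x∙yz≈y∙xz; xy∙z≈y∙xz)

  1≉0 : ¬ 1# ≈ 0#
  1≉0 = 0≉1 ∘ sym

  x*y≈0⇒y≈0 : ∀ {x y} → ¬ x ≈ 0# → x * y ≈ 0# → y ≈ 0#
  x*y≈0⇒y≈0 {x} {y} x≉0 xy≈0 with inverse x x≉0
  ... | x⁻¹ , xx⁻¹≈1 = begin
    y                ≈⟨ sym (*-identityˡ y) ⟩
    1# * y           ≈⟨ *-congʳ (sym xx⁻¹≈1) ⟩
    (x * x⁻¹) * y    ≈⟨ xy∙z≈y∙xz x x⁻¹ y ⟩
    x⁻¹ * (x * y)    ≈⟨ *-congˡ xy≈0 ⟩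
    x⁻¹ * 0#         ≈⟨ zeroʳ x⁻¹ ⟩
    0#               ∎

  Σ-cong : ∀ {m} {f g : Vector m} → (∀ i → f i ≈ g i) → Σ[ f ] ≈ Σ[ g ]
  Σ-cong {zero}  _   = refl
  Σ-cong {suc m} f≈g = +-cong (f≈g zero) (Σ-cong (f≈g ∘ suc))

  Σ-zero : ∀ {m} {f : Vector m} → (∀ i → f i ≈ 0#) → Σ[ f ] ≈ 0#
  Σ-zero {zero}  _   = refl
  Σ-zero {suc m} f≈0 = trans (+-cong (f≈0 zero) (Σ-zero (f≈0 ∘ suc))) (+-identityˡ 0#)

  Σ-distrib-+ : ∀ {m} (f g : Vector m) → Σ[ (λ i → f i + g i) ] ≈ Σ[ f ] + Σ[ g ]
  Σ-distrib-+ {zero}  _ _ = sym (+-identityˡ 0#)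
  Σ-distrib-+ {suc m} f g = trans (+-congˡ (Σ-distrib-+ (f ∘ suc) (g ∘ suc)))
                                  (interchange (f zero) (g zero) Σ[ f ∘ suc ] Σ[ g ∘ suc ])

  Σ-distrib-neg : ∀ {m} (f : Vector m) → Σ[ (λ i → - f i) ] ≈ - Σ[ f ]
  Σ-distrib-neg {zero}  _ = sym ε⁻¹≈ε
  Σ-distrib-neg {suc m} f =
    trans (+-congˡ (Σ-distrib-neg (f ∘ suc))) (⁻¹-∙-comm (f zero) Σ[ f ∘ suc ])

  Σ-distrib-- : ∀ {m} (f g : Vector m) → Σ[ (λ i → f i - g i) ] ≈ Σ[ f ] - Σ[ g ]
  Σ-distrib-- f g = trans (Σ-distrib-+ f (λ i → - g i)) (+-congˡ (Σ-distrib-neg g))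

  *-distribˡ-Σ : ∀ {m} a (f : Vector m) → a * Σ[ f ] ≈ Σ[ (λ i → a * f i) ]
  *-distribˡ-Σ {zero}  a _ = zeroʳ a
  *-distribˡ-Σ {suc m} a f =
    trans (distribˡ a (f zero) Σ[ f ∘ suc ]) (+-congˡ (*-distribˡ-Σ a (f ∘ suc)))

  Σ-comm : ∀ {m k} (f : Fin m → Fin k → Carrier) →
           Σ[ (λ i → Σ[ f i ]) ] ≈ Σ[ (λ j → Σ[ (λ i → f i j) ]) ]
  Σ-comm {zero}  {k} _ = sym (Σ-zero {k} (λ _ → refl))
  Σ-comm {suc m}     f = trans (+-congˡ (Σ-comm (f ∘ suc)))
                               (sym (Σ-distrib-+ (f zero) (λ j → Σ[ (λ i → f (suc i) j) ])))

  Σ-single : ∀ {m} {f : Vector m} d → (∀ j → j ≢ d → f j ≈ 0#) → Σ[ f ] ≈ f d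
  Σ-single {suc m} {f} zero    f≈0 =
    trans (+-congˡ (Σ-zero (λ i → f≈0 (suc i) (λ ())))) (+-identityʳ (f zero))
  Σ-single {suc m} {f} (suc d) f≈0 =
    trans (+-congʳ (f≈0 zero (λ ())))
      (trans (+-identityˡ _) (Σ-single d (λ j j≢d → f≈0 (suc j) (j≢d ∘ Fin.suc-injective))))

  -- Additivity in the only form the pigeonhole argument needs.
  PreservesSubtraction : ∀ {k m} → (Vector k → Vector m) → Set (c ⊔ ℓ)
  PreservesSubtraction g = ∀ x y i → g (λ j → x j - y j) i ≈ g x i - g y i

  ·-cong : ∀ {m} (B : Matrix m) {x y : Vector m} → (∀ i → x i ≈ y i) → ∀ i → (B · x) i ≈ (B · y) i
  ·-cong B x≈y i = Σ-cong (λ k → *-congˡ (x≈y k))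

  ·-preservesSubtraction : ∀ {m} (B : Matrix m) → PreservesSubtraction (B ·_)
  ·-preservesSubtraction B x y i =
    trans (Σ-cong (λ k → x[y-z]≈xy-xz (B i k) (x k) (y k)))
          (Σ-distrib-- (λ k → B i k * x k) (λ k → B i k * y k))

  iterate-preservesSubtraction : ∀ {m} (B : Matrix m) t → PreservesSubtraction (iterate B t)
  iterate-preservesSubtraction B zero    x y i = refl
  iterate-preservesSubtraction B (suc t) x y i =
    trans (·-cong B (iterate-preservesSubtraction B t x y) i)
          (·-preservesSubtraction B (iterate B t x) (iterate B t y) i)

  iterate-shift : ∀ {m} (B : Matrix m) r v → iterate B r (B · v) ≡ iterate B (suc r) v
  iterate-shift B zero    v = ≡.refl
  iterate-shift B (suc r) v = ≡.cong (B ·_) (iterate-shift B r v)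

  linearCombination : ∀ {k m} → Vector k → (Fin k → Vector m) → Vector m
  linearCombination cc ys i = Σ[ (λ j → cc j * ys j i) ]

  linearCombination-preservesSubtraction : ∀ {k m} (ys : Fin k → Vector m) →
                                           PreservesSubtraction (λ cc → linearCombination cc ys)
  linearCombination-preservesSubtraction ys x y i =
    trans (Σ-cong (λ j → [y-z]x≈yx-zx (ys j i) (x j) (y j)))
          (Σ-distrib-- (λ j → x j * ys j i) (λ j → y j * ys j i))

  ·-linearCombination : ∀ {k m} (B : Matrix m) cc (ys : Fin k → Vector m) i →
    linearCombination cc (λ j → B · ys j) i ≈ (B · linearCombination cc ys) i
  ·-linearCombination B cc ys i = begin
    Σ[ (λ j → cc j * Σ[ (λ l → B i l * ys j l) ]) ]
      ≈⟨ Σ-cong (λ j → *-distribˡ-Σ (cc j) (λ l → B i l * ys j l)) ⟩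
    Σ[ (λ j → Σ[ (λ l → cc j * (B i l * ys j l)) ]) ]
      ≈⟨ Σ-comm (λ j l → cc j * (B i l * ys j l)) ⟩
    Σ[ (λ l → Σ[ (λ j → cc j * (B i l * ys j l)) ]) ]
      ≈⟨ Σ-cong (λ l → Σ-cong (λ j → x∙yz≈y∙xz (cc j) (B i l) (ys j l))) ⟩
    Σ[ (λ l → Σ[ (λ j → B i l * (cc j * ys j l)) ]) ]
      ≈⟨ Σ-cong (λ l → sym (*-distribˡ-Σ (B i l) (λ j → cc j * ys j l))) ⟩
    Σ[ (λ l → B i l * Σ[ (λ j → cc j * ys j l) ]) ]
      ∎

  orbit-relation-propagates : ∀ {k m} (B : Matrix m) (cc : Vector k) u →
    (∀ i → linearCombination cc (λ j → iterate B (toℕ j) u) i ≈ 0#) →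
    ∀ t i → linearCombination cc (λ j → iterate B (t ℕ.+ toℕ j) u) i ≈ 0#
  orbit-relation-propagates B cc u rel zero    i = rel i
  orbit-relation-propagates B cc u rel (suc t) i =
    trans (·-linearCombination B cc (λ j → iterate B (t ℕ.+ toℕ j) u) i)
          (Σ-zero (λ l → trans (*-congˡ (orbit-relation-propagates B cc u rel t l)) (zeroʳ (B i l))))

  LeadingIndex : ∀ {m} → Vector m → Fin m → Set ℓ
  LeadingIndex cc d = ¬ cc d ≈ 0# × (∀ j → d Fin.< j → cc j ≈ 0#)

  recurrence-vanishes : ∀ {m} {cc : Vector m} {d} → LeadingIndex cc d → (s : ℕ → Carrier) →
    (∀ t → Σ[ (λ j → cc j * s (t ℕ.+ toℕ j)) ] ≈ 0#) →
    (∀ r → r < toℕ d → s r ≈ 0#) → ∀ r → s r ≈ 0#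
  recurrence-vanishes {cc = cc} {d} (cd≉0 , cc≈0-above) s rel initial = <-rec _ step
    where
    step : ∀ r → (∀ {r′} → r′ < r → s r′ ≈ 0#) → s r ≈ 0#
    step r earlier with r <? toℕ d
    ... | yes r<d = initial r r<d
    ... | no r≮d = x*y≈0⇒y≈0 cd≉0 (begin
      cc d * s r                           ≡⟨ ≡.cong (λ x → cc d * s x) (≡.sym t+d≡r) ⟩
      cc d * s (t ℕ.+ toℕ d)               ≈⟨ sym (Σ-single d other-terms≈0) ⟩
      Σ[ (λ j → cc j * s (t ℕ.+ toℕ j)) ]  ≈⟨ rel t ⟩
      0#                                   ∎)
      where
      t = r ∸ toℕ d
      t+d≡r : t ℕ.+ toℕ d ≡ r
      t+d≡r = m∸n+n≡m (≮⇒≥ r≮d)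
      other-terms≈0 : ∀ j → j ≢ d → cc j * s (t ℕ.+ toℕ j) ≈ 0#
      other-terms≈0 j j≢d with <-cmp (toℕ j) (toℕ d)
      ... | tri< j<d _ _ =
        trans (*-congˡ (earlier (≡.subst (t ℕ.+ toℕ j <_) t+d≡r (+-monoʳ-< t j<d)))) (zeroʳ (cc j))
      ... | tri≈ _ j≡d _ = ⊥-elim (j≢d (toℕ-injective j≡d))
      ... | tri> _ _ d<j = trans (*-congʳ (cc≈0-above j d<j)) (zeroˡ _)

  ∼-preserves-≉0 : ∀ {m} {v w : Vector m} → v ∼ w → ∀ {i} → ¬ w i ≈ 0# → ¬ v i ≈ 0#
  ∼-preserves-≉0 (λ′ , λ′≉0 , v≈λ′w) {i} wi≉0 vi≈0 =
    wi≉0 (x*y≈0⇒y≈0 λ′≉0 (trans (sym (v≈λ′w i)) vi≈0))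

  ∼-preserves-≈0 : ∀ {m} {v w : Vector m} → v ∼ w → ∀ {i} → w i ≈ 0# → v i ≈ 0#
  ∼-preserves-≈0 (λ′ , _ , v≈λ′w) {i} wi≈0 = trans (v≈λ′w i) (trans (*-congˡ wi≈0) (zeroʳ λ′))

  ones : ∀ {m} → Vector m
  ones _ = 1#

  zeroThenOnes : ∀ {m} → Vector (suc m)
  zeroThenOnes zero    = 0#
  zeroThenOnes (suc _) = 1#

  zeroThenOnes-InU : ∀ {n} → 1 ≤ n → InU (zeroThenOnes {n})
  zeroThenOnes-InU {suc n} _ = 1≉0

  1<q : ∀ {q} → HasCardinality F q → 1 < q
  1<q {zero}        card = ⊥-elim (Fin.¬Fin0 (Inverse.to card 0#))
  1<q {suc zero}    card = ⊥-elim (0≉1 (begin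
    0#            ≈⟨ sym (strictlyInverseʳ 0#) ⟩
    from (to 0#)  ≡⟨ ≡.cong from (Fin1-unique (to 0#) (to 1#)) ⟩
    from (to 1#)  ≈⟨ strictlyInverseʳ 1# ⟩
    1#            ∎))
    where
    open Inverse card using (to; from; strictlyInverseʳ)
    Fin1-unique : (a b : Fin 1) → a ≡ b
    Fin1-unique zero zero = ≡.refl
  1<q {suc (suc q)} _ = s≤s (s≤s z≤n)

module FiniteFieldFacts {c ℓ} (F : Field c ℓ) {q} (card : HasCardinality F q) where
  open Field F hiding (zero)
  open LinearAlgebra F
  open FieldFacts F
  open Inverse card using (to; from; to-cong; strictlyInverseˡ; strictlyInverseʳ)
  open import Algebra.Properties.Group +-group using (x∙y⁻¹≈ε⇒x≈y; x≈y⇒x∙y⁻¹≈ε)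

  to-injective : ∀ {x y} → to x ≡ to y → x ≈ y
  to-injective {x} {y} tx≡ty =
    trans (sym (strictlyInverseʳ x)) (trans (reflexive (≡.cong from tx≡ty)) (strictlyInverseʳ y))

  infix 4 _≟_
  _≟_ : Decidable _≈_
  x ≟ y with to x Fin.≟ to y
  ... | yes tx≡ty = yes (to-injective tx≡ty)
  ... | no tx≢ty  = no (tx≢ty ∘ to-cong)

  encode : ∀ {k} → Vector k → Fin (q ^ k)
  encode v = funToFin (to ∘ v)

  decode : ∀ {k} → Fin (q ^ k) → Vector k
  decode i = from ∘ finToFun i

  funToFin-cong : ∀ {k} {f g : Fin k → Fin q} → (∀ i → f i ≡ g i) → funToFin f ≡ funToFin g
  funToFin-cong {zero}  _   = ≡.refl
  funToFin-cong {suc k} f≡g = ≡.cong₂ Fin.combine (f≡g zero) (funToFin-cong (f≡g ∘ suc))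

  encode-cong : ∀ {k} {u v : Vector k} → (∀ i → u i ≈ v i) → encode u ≡ encode v
  encode-cong u≈v = funToFin-cong (to-cong ∘ u≈v)

  encode-injective : ∀ {k} {u v : Vector k} → encode u ≡ encode v → ∀ i → u i ≈ v i
  encode-injective {u = u} {v} eu≡ev i = to-injective (begin
    to (u i)               ≡⟨ finToFun-funToFin (to ∘ u) i ⟨
    finToFun (encode u) i  ≡⟨ ≡.cong (λ w → finToFun w i) eu≡ev ⟩
    finToFun (encode v) i  ≡⟨ finToFun-funToFin (to ∘ v) i ⟩
    to (v i)               ∎)
    where open ≡.≡-Reasoning

  encode-decode : ∀ {k} (i : Fin (q ^ k)) → encode (decode {k} i) ≡ i
  encode-decode {k} i =
    ≡.trans (funToFin-cong (strictlyInverseˡ ∘ finToFun {q} {k} i)) (funToFin-finToFin {k} {q} i)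

  -- Pigeonhole: 𝔽_qᵏ has more elements than 𝔽_qᵐ, so g identifies two distinct vectors.
  nontrivial-kernel : ∀ {k m} → m < k → (g : Vector k → Vector m) → PreservesSubtraction g →
                      ∃ λ z → NonZeroVec z × (∀ i → g z i ≈ 0#)
  nontrivial-kernel {k} m<k g g-sub
    with pigeonhole (^-monoʳ-< q (1<q card) m<k) (encode ∘ g ∘ decode {k})
  ... | i , j , i<j , gx≡gy = (λ l → x l - y l) , x-y≢0 ,
                              (λ l → trans (g-sub x y l) (x≈y⇒x∙y⁻¹≈ε (encode-injective gx≡gy l)))
    where
    x y : Vector k
    x = decode {k} i
    y = decode {k} j
    x≉y : ¬ (∀ l → x l ≈ y l)
    x≉y x≈y = Fin.<⇒≢ i<j (≡.trans (≡.sym (encode-decode {k} i))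
                             (≡.trans (encode-cong x≈y) (encode-decode {k} j)))
    x-y≢0 : NonZeroVec (λ l → x l - y l)
    x-y≢0 with ¬∀⟶∃¬ k (λ l → x l ≈ y l) (λ l → x l ≟ y l) x≉y
    ... | l , xl≉yl = l , xl≉yl ∘ x∙y⁻¹≈ε⇒x≈y (x l) (y l)

  leadingIndex : ∀ {m} (cc : Vector m) → NonZeroVec cc → ∃ (LeadingIndex cc)
  leadingIndex {suc m} cc (j , cj≉0) with any? (λ l → ¬? (cc (suc l) ≟ 0#))
  ... | yes tail≢0 with leadingIndex (cc ∘ suc) tail≢0
  ...   | d , cd≉0 , above = suc d , cd≉0 , λ { zero () ; (suc l) (s≤s d<l) → above l d<l }
  leadingIndex {suc m} cc (j , cj≉0) | no tail≡0 =
    zero , head≉0 j cj≉0 , λ { zero () ; (suc l) _ → decidable-stable (cc (suc l) ≟ 0#) (tail≡0 ∘ (l ,_)) }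
    where
    head≉0 : ∀ l → ¬ cc l ≈ 0# → ¬ cc zero ≈ 0#
    head≉0 zero    cl≉0 = cl≉0
    head≉0 (suc l) cl≉0 = ⊥-elim (tail≡0 (l , cl≉0))

  -- u, Bu, …, Bᵐu are dependent in dimension m, so every coordinate of the orbit satisfies a
  -- linear recurrence of order at most m.
  coordinate-vanishing : ∀ {m} (B : Matrix m) u i →
    (∀ r → r < m → iterate B r u i ≈ 0#) → ∀ r → iterate B r u i ≈ 0#
  coordinate-vanishing {m} B u i initial
    with nontrivial-kernel (n<1+n m)
           (λ cc → linearCombination cc (λ j → iterate B (toℕ j) u))
           (linearCombination-preservesSubtraction (λ (j : Fin (suc m)) → iterate B (toℕ j) u))
  ... | cc , cc≢0 , relation with leadingIndex cc cc≢0
  ...   | d , leading = recurrence-vanishes leading (λ r → iterate B r u i)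
                          (λ t → orbit-relation-propagates B cc u relation t i)
                          (λ r r<d → initial r (<-≤-trans r<d (ℕ.s≤s⁻¹ (toℕ<n d))))

module TransitiveDynamics {c ℓ} (F : Field c ℓ) {q} (card : HasCardinality F q) {n}
  (A : LinearAlgebra.Matrix F (suc n)) (transitive : LinearAlgebra.Transitive F A) where
  open Field F hiding (zero)
  open LinearAlgebra F
  open FieldFacts F
  open FiniteFieldFacts F card

  last : Fin (suc n)
  last = fromℕ n

  orbit-meets-U : ∀ {u} → NonZeroVec u → ∃ λ k → InU (iterate A k u)
  orbit-meets-U {u} u≢0 with transitive u ones u≢0 (last , 1≉0)
  ... | k , Aᵏu∼1 = k , ∼-preserves-≉0 Aᵏu∼1 1≉0

  -- [v] cannot equal both of the two distinct points [1:…:1] and [0:1:…:1] of U.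
  orbit-returns-to-U : 1 ≤ n → ∀ {v} → InU v → ∃ λ k → InU (iterate A (suc k) v)
  orbit-returns-to-U 1≤n {v} v∈U
    with transitive v ones (last , v∈U) (last , 1≉0)
       | transitive v zeroThenOnes (last , v∈U) (last , zeroThenOnes-InU 1≤n)
  ... | suc k , v∼1 | _           = k , ∼-preserves-≉0 v∼1 1≉0
  ... | zero  , _   | suc k , v∼χ = k , ∼-preserves-≉0 v∼χ (zeroThenOnes-InU 1≤n)
  ... | zero  , v∼1 | zero  , v∼χ = ⊥-elim (∼-preserves-≉0 v∼1 {zero} 1≉0 (∼-preserves-≈0 v∼χ refl))

  no-long-excursion : 1 ≤ n → ∀ {v} → InU v → ¬ (∀ j → j < suc n → iterate A (suc j) v last ≈ 0#)
  no-long-excursion 1≤n {v} v∈U excursion with orbit-returns-to-U 1≤n v∈U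
  ... | k , returns = returns (≡.subst (λ w → w last ≈ 0#) (iterate-shift A k v)
                        (coordinate-vanishing A (A · v) last shifted k))
    where
    shifted : ∀ r → r < suc n → iterate A r (A · v) last ≈ 0#
    shifted r r<n = ≡.subst (λ w → w last ≈ 0#) (≡.sym (iterate-shift A r v)) (excursion r r<n)

  jumpIndex-bounded : 1 ≤ n → ∀ v → InU v → ∃ λ k → IsJumpIndexAt A v k × k ≤ suc n
  jumpIndex-bounded 1≤n v v∈U =
    first-return (¬∀⟶∃¬-smallest (suc n) Outside (λ i → iterate A (suc (toℕ i)) v last ≟ 0#)
                                 (no-long-excursion 1≤n v∈U ∘ excursion))
    where
    Outside : Fin (suc n) → Set ℓ
    Outside i = iterate A (suc (toℕ i)) v last ≈ 0#
    excursion : (∀ i → Outside i) → ∀ j → j < suc n → iterate A (suc j) v last ≈ 0#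
    excursion outside j j<n =
      ≡.subst (λ x → iterate A (suc x) v last ≈ 0#) (toℕ-fromℕ< j<n) (outside (fromℕ< j<n))
    first-return : (∃ λ i → ¬ Outside i × (∀ (j : Fin (toℕ i)) → Outside (inject j))) →
                   ∃ λ k → IsJumpIndexAt A v k × k ≤ suc n
    first-return (i , inside , outside-before) = suc (toℕ i) , (s≤s z≤n , inside , before) , toℕ<n i
      where
      before : ∀ j → 1 ≤ j → j < suc (toℕ i) → ¬ InU (iterate A j v)
      before (suc j) _ (s≤s j<i) j∈U = j∈U (≡.subst (λ x → iterate A (suc x) v last ≈ 0#)
        (≡.trans (toℕ-inject (fromℕ< j<i)) (toℕ-fromℕ< j<i)) (outside-before (fromℕ< j<i)))

  ∃-n-step-excursion : ∃ λ z → NonZeroVec z × (∀ j → j < n → iterate A (suc j) z last ≈ 0#)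
  ∃-n-step-excursion with nontrivial-kernel (n<1+n n) (λ x j → iterate A (suc (toℕ j)) x last)
                                         (λ x y j → iterate-preservesSubtraction A (suc (toℕ j)) x y last)
  ... | z , z≢0 , kernel = z , z≢0 , λ j j<n →
    ≡.subst (λ x → iterate A (suc x) z last ≈ 0#) (toℕ-fromℕ< j<n) (kernel (fromℕ< j<n))

  excursion-starts-in-U : ∀ {z} → NonZeroVec z → (∀ j → j < n → iterate A (suc j) z last ≈ 0#) → InU z
  excursion-starts-in-U {z} z≢0 outside z-last≈0 with orbit-meets-U z≢0
  ... | k , Aᵏz∈U = Aᵏz∈U (coordinate-vanishing A z last vanishes k)
    where
    vanishes : ∀ r → r < suc n → iterate A r z last ≈ 0#
    vanishes zero    _         = z-last≈0
    vanishes (suc r) (s≤s r<n) = outside r r<n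

  jumpIndex-attained : 1 ≤ n → ∃ λ v → InU v × IsJumpIndexAt A v (suc n)
  jumpIndex-attained 1≤n with ∃-n-step-excursion
  ... | z , z≢0 , outside = z , z∈U , s≤s z≤n , returns , before
    where
    z∈U : InU z
    z∈U = excursion-starts-in-U z≢0 outside
    before : ∀ j → 1 ≤ j → j < suc n → ¬ InU (iterate A j z)
    before (suc j) _ (s≤s j<n) j∈U = j∈U (outside j j<n)
    outside-through-n : iterate A (suc n) z last ≈ 0# → ∀ j → j < suc n → iterate A (suc j) z last ≈ 0#
    outside-through-n at-n j j<1+n with m<1+n⇒m<n∨m≡n j<1+n
    ... | inj₁ j<n    = outside j j<n
    ... | inj₂ ≡.refl = at-n
    returns : InU (iterate A (suc n) z)
    returns = no-long-excursion 1≤n z∈U ∘ outside-through-n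

mainTheorem3 : ∀ {c ℓ} (q : ℕ) → IsPrimePower q → (F : Field c ℓ) → HasCardinality F q →
               (n : ℕ) → 1 ≤ n → (A : LinearAlgebra.Matrix F (suc n)) →
               LinearAlgebra.Invertible F A → LinearAlgebra.Transitive F A →
               LinearAlgebra.IsAbsoluteJumpIndex F A (suc n)
mainTheorem3 q _ F card n 1≤n A _ transitive = jumpIndex-bounded 1≤n , jumpIndex-attained 1≤n
  where open TransitiveDynamics F card A transitive
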